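{- Work in intensional Martin-Löf type theory with a cumulative hierarchy of univalent universes. Let $\mathcal{U}$ be a universe and let $\mathcal{U}_\bullet :\equiv \sum_{A:\mathcal{U}} A$. For a pointed type $(A,a)$ define the type of pointed families $\mathsf{PFam}(A,a) :\equiv \sum_{P : A \to \mathcal{U}} P(a)$. Define $\Sigma^\bullet : \big(\sum_{\mathbf{A}:\mathcal{U}_\bullet} \mathsf{PFam}(\mathbf{A})\big) \to \mathcal{U}_\bullet$ by $\Sigma^\bullet((A,a),(P,p)) :\equiv \big(\sum_{x:A} P(x), (a,p)\big)$, and define $\tilde\Omega : \mathsf{PFam}(A,a) \to \mathsf{PFam}(\Omega(A,a))$ by $\tilde\Omega(P,p) :\equiv \big(\lambda q.\ (\mathsf{transport}^P(q,p) =_{P(a)} p),\ \mathsf{refl}_p\big)$, and $\langle\Omega,\tilde\Omega\rangle(\mathbf{A},\mathbf{P}) :\equiv (\Omega\mathbf{A}, \tilde\Omega\mathbf{P})$. Then, as functions $\big(\sum_{\mathbf{A}:\mathcal{U}_\bullet} \mathsf{PFam}(\mathbf{A})\big) \to \mathcal{U}_\bullet$, $$\Omega \circ \Sigma^\bullet = \Sigma^\bullet \circ \langle \Omega, \tilde\Omega\rangle .$$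
   Context: The ambient theory is intensional Martin-Löf type theory (with $\Pi$, $\Sigma$, identity types, $\mathbf{0},\mathbf{1},\mathbf{2},\mathbb{N}$) together with a cumulative hierarchy of universes $\mathcal{U}_0:\mathcal{U}_1:\mathcal{U}_2:\dots$, each satisfying Voevodsky's univalence axiom; no higher inductive types are assumed. "$=$" denotes the identity type. A pointed type is a pair $(A,a)$ with $a:A$. The loop space of a pointed type is $\Omega(A,a) :\equiv ((a =_A a), \mathsf{refl}_a)$. $\mathsf{transport}^P(q,p)$ denotes transport of $p:P(a)$ along a path $q$ in the family $P$. -}

{-# OPTIONS --without-K #-}
module Defs where

open import Level using (Level; suc; _⊔_)
open import Data.Product using (Σ; _×_; _,_)
open import Relation.Binary.PropositionalEquality using (_≡_; refl; subst)
open import Function using (id)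

-- Equivalences (bi-invertible maps, HoTT book 4.3) and univalence.
isEquiv : ∀ {a b} {A : Set a} {B : Set b} → (A → B) → Set (a ⊔ b)
isEquiv {A = A} {B} f = (Σ (B → A) λ g → ∀ x → g (f x) ≡ x)
                      × (Σ (B → A) λ h → ∀ y → f (h y) ≡ y)

_≃_ : ∀ {a b} → Set a → Set b → Set (a ⊔ b)
A ≃ B = Σ (A → B) isEquiv

idtoeqv : ∀ {ℓ} {A B : Set ℓ} → A ≡ B → A ≃ B
idtoeqv refl = id , ((id , λ _ → refl) , (id , λ _ → refl))

Univalence : (ℓ : Level) → Set (suc ℓ)
Univalence ℓ = (A B : Set ℓ) → isEquiv (idtoeqv {ℓ} {A} {B})

U• : (ℓ : Level) → Set (suc ℓ)
U• ℓ = Σ (Set ℓ) λ A → A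

Ω : ∀ {ℓ} → U• ℓ → U• ℓ
Ω (A , a) = (a ≡ a) , refl

PFam : ∀ {ℓ} → U• ℓ → Set (suc ℓ)
PFam {ℓ} (A , a) = Σ (A → Set ℓ) λ P → P a

Σ• : ∀ {ℓ} → Σ (U• ℓ) PFam → U• ℓ
Σ• ((A , a) , (P , p)) = Σ A P , (a , p)

Ω̃ : ∀ {ℓ} {𝐀 : U• ℓ} → PFam 𝐀 → PFam (Ω 𝐀)
Ω̃ {𝐀 = A , a} (P , p) = (λ q → subst P q p ≡ p) , refl

⟨Ω,Ω̃⟩ : ∀ {ℓ} → Σ (U• ℓ) PFam → Σ (U• ℓ) PFam
⟨Ω,Ω̃⟩ (𝐀 , 𝐏) = Ω 𝐀 , Ω̃ 𝐏

{-# OPTIONS --without-K #-}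
module Submission where

-- Both Ω (Σ• 𝐀 𝐏) and Σ• (Ω 𝐀, Ω̃ 𝐏) are pointed types whose carriers are related by the
-- standard characterisation of paths in a Σ-type, (a , p) ≡ (a , p) ≃ Σ (q : a ≡ a) (q* p ≡ p),
-- and that equivalence sends refl to (refl , refl).  Univalence turns this pointed equivalence
-- into a pointed path for each argument, and function extensionality, itself a consequence of
-- univalence, assembles these paths into the equality of functions.

open import Defs
open import Level using (Level)
open import Data.Product using (Σ; _,_; proj₁; proj₂)
open import Data.Product.Properties using (Σ-≡,≡→≡; Σ-≡,≡↔≡)
open import Function using (_∘_; id; _↔_; Inverse)
open import Function.Properties.Inverse using (↔-sym)
open import Relation.Binary.PropositionalEquality using (_≡_; refl; subst; cong; module ≡-Reasoning)

↔⇒≃ : ∀ {a b} {A : Set a} {B : Set b} → A ↔ B → A ≃ B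
↔⇒≃ A↔B = to , (from , strictlyInverseʳ) , (from , strictlyInverseˡ)
  where open Inverse A↔B

Σ-≡≃Σ-≡,≡ : ∀ {a b} {A : Set a} {B : A → Set b} {u v : Σ A B}
           → (u ≡ v) ≃ Σ (proj₁ u ≡ proj₁ v) (λ q → subst B q (proj₂ u) ≡ proj₂ v)
Σ-≡≃Σ-≡,≡ = ↔⇒≃ (↔-sym Σ-≡,≡↔≡)

subst-id≡idtoeqv : ∀ {k} {A B : Set k} (p : A ≡ B) (x : A) → subst id p x ≡ proj₁ (idtoeqv p) x
subst-id≡idtoeqv refl x = refl

∘-idtoeqv-injective : ∀ {k c} {A B : Set k} {C : Set c} (p : A ≡ B) {h₁ h₂ : B → C}
                    → h₁ ∘ proj₁ (idtoeqv p) ≡ h₂ ∘ proj₁ (idtoeqv p) → h₁ ≡ h₂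
∘-idtoeqv-injective refl eq = eq

Paths : ∀ {k} → Set k → Set k
Paths A = Σ A λ x → Σ A λ y → x ≡ y

diagonal≃ : ∀ {k} (A : Set k) → A ≃ Paths A
diagonal≃ A = (λ x → x , x , refl) , (proj₁ , λ _ → refl) , (proj₁ , diagonal-proj₁)
  where
    diagonal-proj₁ : (u : Paths A) → (proj₁ u , proj₁ u , refl) ≡ u
    diagonal-proj₁ (x , .x , refl) = refl

module _ (univalence : ∀ {k : Level} → Univalence k) where

  ua : ∀ {k} {A B : Set k} → A ≃ B → A ≡ B
  ua {A = A} {B} = proj₁ (proj₂ (univalence A B))

  idtoeqv-ua : ∀ {k} {A B : Set k} (e : A ≃ B) → idtoeqv (ua e) ≡ e
  idtoeqv-ua {A = A} {B} = proj₂ (proj₂ (univalence A B))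

  ∘-≃-injective : ∀ {k c} {A B : Set k} {C : Set c} (e : A ≃ B) {h₁ h₂ : B → C}
                → h₁ ∘ proj₁ e ≡ h₂ ∘ proj₁ e → h₁ ≡ h₂
  ∘-≃-injective e {h₁} {h₂} =
    subst (λ e′ → h₁ ∘ proj₁ e′ ≡ h₂ ∘ proj₁ e′ → h₁ ≡ h₂) (idtoeqv-ua e) (∘-idtoeqv-injective (ua e))

  -- Both projections agree after precomposition with the diagonal, which is an equivalence.
  source≡target : ∀ {k} (A : Set k) → _≡_ {A = Paths A → A} proj₁ (proj₁ ∘ proj₂)
  source≡target A = ∘-≃-injective (diagonal≃ A) refl

  funext : ∀ {j k} {X : Set j} {A : Set k} {f g : X → A} → (∀ x → f x ≡ g x) → f ≡ g
  funext {A = A} {f} {g} f≗g = cong (λ π x → π (f x , g x , f≗g x)) (source≡target A)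

  ua• : ∀ {k} {A B : Set k} {a : A} {b : B} (e : A ≃ B) → proj₁ e a ≡ b
      → _≡_ {A = U• k} (A , a) (B , b)
  ua• {a = a} {b} e ea≡b = Σ-≡,≡→≡ (ua e , transport-ua)
    where
      open ≡-Reasoning
      transport-ua : subst id (ua e) a ≡ b
      transport-ua = begin
        subst id (ua e) a          ≡⟨ subst-id≡idtoeqv (ua e) a ⟩
        proj₁ (idtoeqv (ua e)) a   ≡⟨ cong (λ e′ → proj₁ e′ a) (idtoeqv-ua e) ⟩
        proj₁ e a                  ≡⟨ ea≡b ⟩
        b                          ∎

lemma4p5 : (ua : ∀ {k : Level} → Univalence k) → ∀ {ℓ : Level}
    → _≡_ {A = Σ (U• ℓ) PFam → U• ℓ} (Ω ∘ Σ•) (Σ• ∘ ⟨Ω,Ω̃⟩)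
lemma4p5 univalence = funext univalence λ where
  ((A , a) , (P , p)) → ua• univalence (Σ-≡≃Σ-≡,≡ {B = P} {u = a , p} {v = a , p}) refl
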